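{- Let $\frac mn$ be a positive irreducible fraction. Let $m=m_1+\cdots+m_e$ be any integer partition with $e\ge1$ and $1\le m_1\le\cdots\le m_e\le m$. Then there are infinitely many ways to choose a positive integer $k_e$ and a sequence $n_1,\dots,n_{k_e}$ of positive integers (not necessarily distinct) such that \[ \frac mn=\frac1{n_1}+\cdots+\frac1{n_{k_e}} \] and $S_e=T_e$, where \[ S_e:=\Big\{\sum_{i\in I}\tfrac1{n_i}\in\tfrac1n\mathbb Z : I\subseteq\{1,\dots,k_e\}\Big\},\qquad T_e:=\Big\{\sum_{i\in I}\tfrac{m_i}{n} : I\subseteq\{1,\dots,e\}\Big\}. \]
   Context: $\frac1n\mathbb Z=\{\frac cn: c\in\mathbb Z\}$. $S_e$ is the set of those subset sums of the $\frac1{n_i}$ (over index sets $I$, the empty sum being $0$) that lie in $\frac1n\mathbb Z$. -}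

module Defs where

open import Data.Nat as ℕ using (ℕ; zero; suc; NonZero)
open import Data.Integer using (ℤ; +_)
open import Data.Rational using (ℚ; 0ℚ; _+_; _/_)
open import Data.Vec using (Vec; []; _∷_; map; lookup; foldr′)
open import Data.Fin.Subset using (Subset; inside; outside)
open import Data.Product using (Σ; ∃; _×_; _,_)
open import Relation.Binary.PropositionalEquality using (_≡_)
open import Function.Bundles using (_⇔_)

-- 1 / a as a rational number (a = 0 is sent to 0; only used for a ≥ 1)
recip : ℕ → ℚ
recip zero    = 0ℚ
recip (suc a) = + 1 / suc a

subsetSum : ∀ {k} → Vec ℚ k → Subset k → ℚ
subsetSum []       []             = 0ℚ
subsetSum (x ∷ xs) (inside  ∷ I) = x + subsetSum xs I
subsetSum (x ∷ xs) (outside ∷ I) = subsetSum xs I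

sumℚ : ∀ {k} → Vec ℚ k → ℚ
sumℚ = foldr′ _+_ 0ℚ

InFracZ : (n : ℕ) → .{{_ : NonZero n}} → ℚ → Set
InFracZ n q = ∃ λ (c : ℤ) → q ≡ c / n

S : (n : ℕ) → .{{_ : NonZero n}} → ∀ {k} → Vec ℕ k → ℚ → Set
S n ns q = Σ (Subset _) (λ I → q ≡ subsetSum (map recip ns) I) × InFracZ n q

T : (n : ℕ) → .{{_ : NonZero n}} → ∀ {e} → Vec ℕ e → ℚ → Set
T n ms q = Σ (Subset _) (λ I → q ≡ subsetSum (map (λ mi → + mi / n) ms) I)

Good : (m n : ℕ) → .{{_ : NonZero n}} → ∀ {e} → Vec ℕ e → Σ ℕ (Vec ℕ) → Set
Good m n ms (k , ns) =
  (1 ℕ.≤ k)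
  × (∀ i → 1 ℕ.≤ lookup ns i)
  × (+ m / n ≡ sumℚ (map recip ns))
  × (∀ q → S n ns q ⇔ T n ms q)

-- Take L larger than the length of every excluded solution. For a part x ≥ 1 a chain of blocks,
-- M j - 1 copies of 1 / M j for the pairwise coprime M j = 1 + L R j (j < x), has no nonzero
-- integral subset sum; topping it up with u copies of 1 / N and one 1 / (R N) gives a group with
-- sum x whose only integral subset sums are 0 and x. The groups for m_1, …, m_e get pairwise
-- coprime denominators, so the integral subset sums of their concatenation are exactly the
-- subset sums of the m_i; multiplying every denominator by n turns this into S_e = T_e.
module Submission where

open import Defs
open import Data.Nat using (ℕ; NonZero; _≤_)
open import Data.Nat.Coprimality using (Coprime)
open import Data.Vec using (Vec; lookup; sum)
open import Data.Fin using (Fin) renaming (_≤_ to _≤ᶠ_)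
open import Data.List using (List)
open import Data.List.Membership.Propositional using (_∉_)
open import Data.Product using (Σ; ∃; _×_)
open import Relation.Binary.PropositionalEquality using (_≡_)

open import Algebra.Bundles using (CommutativeMonoid)
open import Data.Fin as Fin using ()
open import Data.Fin.Subset using (Subset; inside; outside; ⊤; ⊥; ∁; ∣_∣)
open import Data.Fin.Subset.Properties using (∣p∣≤n; ∣⊤∣≡n)
open import Data.Integer as ℤ using (ℤ; +_)
open import Data.Integer.Properties using (pos-*; pos-+; abs-*)
open import Data.List as List using ()
open import Data.List.Extrema.Nat using (max; xs≤max)
open import Data.List.Membership.Propositional.Properties using (∈-map⁺)
import Data.List.Relation.Unary.All as ListAll
open import Data.Nat using (zero; suc; pred; _+_; _*_; _<_; z≤n; s≤s)
open import Data.Nat.Coprimality as Coprime using (coprime-divisor; coprime-+)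
open import Data.Nat.Divisibility
  using (_∣_; divides; _∣0; ∣1⇒≡1; ∣-trans; ∣m+n∣m⇒∣n; ∣m∣n⇒∣m+n; ∣m⇒∣m*n; m∣m*n; n∣m*n; >⇒∤)
open import Data.Nat.Properties
  using (+-comm; *-comm; *-suc; *-zeroʳ; *-identityˡ; *-identityʳ; +-identityʳ; *-cancelʳ-≡; m*n≢0;
         suc-injective; ≤-refl; ≤-trans; <⇒≱; m≤m+n; m≤m*n; m≤n*m; module ≤-Reasoning)
open import Data.Nat.Tactic.RingSolver using (solve-∀)
open import Data.Product using (_,_; proj₁)
open import Data.Rational as ℚ using (ℚ; 0ℚ; _/_; fromℚᵘ)
open import Data.Rational.Properties as ℚ
  using (toℚᵘ-injective; fromℚᵘ-injective; fromℚᵘ-cong; toℚᵘ-fromℚᵘ; toℚᵘ-homo-+; toℚᵘ-homo-*; /-cong; 0/n≡0)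
open import Data.Rational.Unnormalised as ℚᵘ using (mkℚᵘ; *≡*)
import Data.Rational.Unnormalised.Properties as ℚᵘ
open import Data.Sum using (_⊎_; inj₁; inj₂)
open import Data.Vec using ([]; _∷_; _++_; [_]; replicate; map; splitAt)
open import Data.Vec.Properties using (map-++)
open import Data.Vec.Relation.Unary.All as All using (All; []; _∷_)
open import Data.Vec.Relation.Unary.All.Properties using (++⁺; map⁺; lookup⁺)
open import Function.Bundles using (_⇔_; mk⇔)
open import Relation.Binary.PropositionalEquality using (refl; sym; trans; cong; cong₂; subst; module ≡-Reasoning)
open import Relation.Nullary using (contradiction)
open import Algebra.Properties.CommutativeSemigroup
  (CommutativeMonoid.commutativeSemigroup ℚ.+-0-commutativeMonoid) using (x∙yz≈y∙xz; xy∙z≈xz∙y; xy∙z≈y∙xz)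

-- Denominators are written 1 + d, so they are nonzero by construction and the denominator
-- 1 + pred ((1 + d) * (1 + e)) of a sum or product is definitionally (1 + d) * (1 + e).
infix 8 _/1+_

_/1+_ : ℕ → ℕ → ℚ
a /1+ d = + a / suc d

fromℚᵘ-+ : ∀ p q → fromℚᵘ p ℚ.+ fromℚᵘ q ≡ fromℚᵘ (p ℚᵘ.+ q)
fromℚᵘ-+ p q = toℚᵘ-injective (ℚᵘ.≃-trans (toℚᵘ-homo-+ (fromℚᵘ p) (fromℚᵘ q))
  (ℚᵘ.≃-trans (ℚᵘ.+-cong (toℚᵘ-fromℚᵘ p) (toℚᵘ-fromℚᵘ q)) (ℚᵘ.≃-sym (toℚᵘ-fromℚᵘ (p ℚᵘ.+ q)))))

fromℚᵘ-* : ∀ p q → fromℚᵘ p ℚ.* fromℚᵘ q ≡ fromℚᵘ (p ℚᵘ.* q)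
fromℚᵘ-* p q = toℚᵘ-injective (ℚᵘ.≃-trans (toℚᵘ-homo-* (fromℚᵘ p) (fromℚᵘ q))
  (ℚᵘ.≃-trans (ℚᵘ.*-cong (toℚᵘ-fromℚᵘ p) (toℚᵘ-fromℚᵘ q)) (ℚᵘ.≃-sym (toℚᵘ-fromℚᵘ (p ℚᵘ.* q)))))

/1+-cross : ∀ a d b e → a * suc e ≡ b * suc d → a /1+ d ≡ b /1+ e
/1+-cross a d b e eq =
  fromℚᵘ-cong {mkℚᵘ (+ a) d} {mkℚᵘ (+ b) e}
    (*≡* (trans (sym (pos-* a (suc e))) (trans (cong +_ eq) (pos-* b (suc d)))))

/1+-cross⁻¹ : ∀ a d (c : ℤ) e → a /1+ d ≡ c / suc e → a * suc e ≡ ℤ.∣ c ∣ * suc d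
/1+-cross⁻¹ a d c e eq with fromℚᵘ-injective {mkℚᵘ (+ a) d} {mkℚᵘ c e} eq
... | *≡* eqℤ = trans (sym (abs-* (+ a) (+ suc e))) (trans (cong ℤ.∣_∣ eqℤ) (abs-* c (+ suc d)))

+-/1+ : ∀ a d b e → a /1+ d ℚ.+ b /1+ e ≡ (a * suc e + b * suc d) /1+ pred (suc d * suc e)
+-/1+ a d b e = trans (fromℚᵘ-+ (mkℚᵘ (+ a) d) (mkℚᵘ (+ b) e))
  (/-cong (sym (trans (pos-+ (a * suc e) (b * suc d)) (cong₂ ℤ._+_ (pos-* a (suc e)) (pos-* b (suc d))))) refl)

*-/1+ : ∀ a d b e → a /1+ d ℚ.* b /1+ e ≡ (a * b) /1+ pred (suc d * suc e)
*-/1+ a d b e = trans (fromℚᵘ-* (mkℚᵘ (+ a) d) (mkℚᵘ (+ b) e)) (/-cong (sym (pos-* a b)) refl)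

+-/1+-same : ∀ a b d → a /1+ d ℚ.+ b /1+ d ≡ (a + b) /1+ d
+-/1+-same a b d =
  trans (+-/1+ a d b d) (/1+-cross (a * suc d + b * suc d) (pred (suc d * suc d)) (a + b) d (numerators a b d))
  where
  numerators : ∀ a b d → (a * suc d + b * suc d) * suc d ≡ (a + b) * (suc d * suc d)
  numerators = solve-∀

-- Holds even when m or n is 0, because recip 0 = 0.
recip-* : ∀ m n → recip (m * n) ≡ recip m ℚ.* recip n
recip-* zero    n       = sym (ℚ.*-zeroˡ (recip n))
recip-* (suc m) zero    = trans (cong recip (*-zeroʳ m)) (sym (ℚ.*-zeroʳ (recip (suc m))))
recip-* (suc m) (suc n) = sym (*-/1+ 1 m 1 n)

∣⇒coprime-suc : ∀ {b c} → b ∣ c → Coprime b (suc c)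
∣⇒coprime-suc {c = c} b∣c {i} (i∣b , i∣1+c) =
  ∣1⇒≡1 (∣m+n∣m⇒∣n (subst (i ∣_) (+-comm 1 c) i∣1+c) (∣-trans i∣b b∣c))

coprime-∣-split : ∀ {p q} a b → Coprime p q → p * q ∣ a * q + b * p → (p ∣ a) × (q ∣ b)
coprime-∣-split {p} {q} a b p⊥q pq∣ =
  coprime-divisor p⊥q (subst (p ∣_) (*-comm a q) p∣aq) ,
  coprime-divisor (Coprime.sym p⊥q) (subst (q ∣_) (*-comm b p) q∣bp)
  where
  p∣aq : p ∣ a * q
  p∣aq = ∣m+n∣m⇒∣n (subst (p ∣_) (+-comm (a * q) (b * p)) (∣-trans (m∣m*n q) pq∣)) (n∣m*n b)
  q∣bp : q ∣ b * p
  q∣bp = ∣m+n∣m⇒∣n (∣-trans (n∣m*n p) pq∣) (n∣m*n a)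

∣∧<⇒≡0 : ∀ {d c} → d ∣ c → c < d → c ≡ 0
∣∧<⇒≡0 {c = zero}  _   _   = refl
∣∧<⇒≡0 {c = suc c} d∣c c<d = contradiction d∣c (>⇒∤ c<d)

∣-pred-suc*suc : ∀ {a d e} → a ∣ d → a ∣ e → a ∣ pred (suc d * suc e)
∣-pred-suc*suc {e = e} a∣d a∣e = ∣m∣n⇒∣m+n a∣e (∣m⇒∣m*n (suc e) a∣d)

replicate-++ : ∀ {A : Set} m {n} (x : A) → replicate (m + n) x ≡ replicate m x ++ replicate n x
replicate-++ zero    x = refl
replicate-++ (suc m) x = cong (x ∷_) (replicate-++ m x)

replicate⁺ : ∀ {A : Set} {P : A → Set} {x} n → P x → All P (replicate n x)
replicate⁺ zero    Px = []
replicate⁺ (suc n) Px = Px ∷ replicate⁺ n Px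

subsetSum-++ : ∀ {m n} (xs : Vec ℚ m) (ys : Vec ℚ n) I J →
               subsetSum (xs ++ ys) (I ++ J) ≡ subsetSum xs I ℚ.+ subsetSum ys J
subsetSum-++ []       ys []            J = sym (ℚ.+-identityˡ (subsetSum ys J))
subsetSum-++ (x ∷ xs) ys (inside ∷ I)  J =
  trans (cong (x ℚ.+_) (subsetSum-++ xs ys I J)) (sym (ℚ.+-assoc x (subsetSum xs I) (subsetSum ys J)))
subsetSum-++ (x ∷ xs) ys (outside ∷ I) J = subsetSum-++ xs ys I J

subsetSum-⊥ : ∀ {k} (xs : Vec ℚ k) → subsetSum xs ⊥ ≡ 0ℚ
subsetSum-⊥ []       = refl
subsetSum-⊥ (x ∷ xs) = subsetSum-⊥ xs

subsetSum-∁ : ∀ {k} (xs : Vec ℚ k) I → subsetSum xs I ℚ.+ subsetSum xs (∁ I) ≡ subsetSum xs ⊤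
subsetSum-∁ []       []            = refl
subsetSum-∁ (x ∷ xs) (inside ∷ I)  =
  trans (ℚ.+-assoc x (subsetSum xs I) (subsetSum xs (∁ I))) (cong (x ℚ.+_) (subsetSum-∁ xs I))
subsetSum-∁ (x ∷ xs) (outside ∷ I) =
  trans (x∙yz≈y∙xz (subsetSum xs I) x (subsetSum xs (∁ I))) (cong (x ℚ.+_) (subsetSum-∁ xs I))

sumℚ≡subsetSum-⊤ : ∀ {k} (xs : Vec ℚ k) → sumℚ xs ≡ subsetSum xs ⊤
sumℚ≡subsetSum-⊤ []       = refl
sumℚ≡subsetSum-⊤ (x ∷ xs) = cong (x ℚ.+_) (sumℚ≡subsetSum-⊤ xs)

subsetSumℕ : ∀ {e} → Vec ℕ e → Subset e → ℕ
subsetSumℕ []       []            = 0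
subsetSumℕ (m ∷ ms) (inside ∷ J)  = m + subsetSumℕ ms J
subsetSumℕ (m ∷ ms) (outside ∷ J) = subsetSumℕ ms J

subsetSumℕ-⊤ : ∀ {e} (ms : Vec ℕ e) → subsetSumℕ ms ⊤ ≡ sum ms
subsetSumℕ-⊤ []       = refl
subsetSumℕ-⊤ (m ∷ ms) = cong (_+_ m) (subsetSumℕ-⊤ ms)

subsetSum-/1+ : ∀ {e} (ms : Vec ℕ e) d J → subsetSum (map (_/1+ d) ms) J ≡ subsetSumℕ ms J /1+ d
subsetSum-/1+ []       d []            = sym (0/n≡0 (suc d))
subsetSum-/1+ (m ∷ ms) d (inside ∷ J)  =
  trans (cong (m /1+ d ℚ.+_) (subsetSum-/1+ ms d J)) (+-/1+-same m (subsetSumℕ ms J) d)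
subsetSum-/1+ (m ∷ ms) d (outside ∷ J) = subsetSum-/1+ ms d J

recipSum : ∀ {k} → Vec ℕ k → Subset k → ℚ
recipSum ds = subsetSum (map recip ds)

recipSum-++ : ∀ {m n} (xs : Vec ℕ m) (ys : Vec ℕ n) I J →
              recipSum (xs ++ ys) (I ++ J) ≡ recipSum xs I ℚ.+ recipSum ys J
recipSum-++ xs ys I J =
  trans (cong (λ zs → subsetSum zs (I ++ J)) (map-++ recip xs ys)) (subsetSum-++ (map recip xs) (map recip ys) I J)

recipSum-⊤-++ : ∀ {m n} (xs : Vec ℕ m) (ys : Vec ℕ n) →
                recipSum (xs ++ ys) ⊤ ≡ recipSum xs ⊤ ℚ.+ recipSum ys ⊤
recipSum-⊤-++ {m} xs ys = trans (cong (recipSum (xs ++ ys)) (replicate-++ m inside)) (recipSum-++ xs ys ⊤ ⊤)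

recipSum-replicate : ∀ c d I → recipSum (replicate c (suc d)) I ≡ ∣ I ∣ /1+ d
recipSum-replicate zero    d []            = sym (0/n≡0 (suc d))
recipSum-replicate (suc c) d (inside ∷ I)  =
  trans (cong (1 /1+ d ℚ.+_) (recipSum-replicate c d I)) (+-/1+-same 1 ∣ I ∣ d)
recipSum-replicate (suc c) d (outside ∷ I) = recipSum-replicate c d I

recipSum-replicate-⊤ : ∀ c d → recipSum (replicate c (suc d)) ⊤ ≡ c /1+ d
recipSum-replicate-⊤ c d = trans (recipSum-replicate c d ⊤) (cong (_/1+ d) (∣⊤∣≡n c))

recipSum-map-* : ∀ m {k} (ds : Vec ℕ k) I → recipSum (map (m *_) ds) I ≡ recip m ℚ.* recipSum ds I
recipSum-map-* m []       []            = sym (ℚ.*-zeroʳ (recip m))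
recipSum-map-* m (d ∷ ds) (inside ∷ I)  =
  trans (cong₂ ℚ._+_ (recip-* m d) (recipSum-map-* m ds I)) (sym (ℚ.*-distribˡ-+ (recip m) (recip d) (recipSum ds I)))
recipSum-map-* m (d ∷ ds) (outside ∷ I) = recipSum-map-* m ds I

record SubsetSumsOver {k} (ds : Vec ℕ k) (d : ℕ) (Z : ℕ → Set) : Set where
  field
    sums : ∀ I → ∃ λ A → recipSum ds I ≡ A /1+ d × (suc d ∣ A → Z A)

open SubsetSumsOver

subsetSumsOver-[] : ∀ {d} {Z : ℕ → Set} → Z 0 → SubsetSumsOver [] d Z
subsetSumsOver-[] {d} Z0 .sums [] = 0 , sym (0/n≡0 (suc d)) , λ _ → Z0

subsetSumsOver-replicate : ∀ {c d} → c ≤ d → SubsetSumsOver (replicate c (suc d)) d (_≡ 0)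
subsetSumsOver-replicate {c} {d} c≤d .sums I =
  ∣ I ∣ , recipSum-replicate c d I , λ 1+d∣ → ∣∧<⇒≡0 1+d∣ (s≤s (≤-trans (∣p∣≤n I) c≤d))

subsetSumsOver-++ : ∀ {m n} {xs : Vec ℕ m} {ys : Vec ℕ n} {d e} {Z₁ Z₂ Z : ℕ → Set} →
                    Coprime (suc d) (suc e) → SubsetSumsOver xs d Z₁ → SubsetSumsOver ys e Z₂ →
                    (∀ {a b} → Z₁ a → Z₂ b → Z (a * suc e + b * suc d)) →
                    SubsetSumsOver (xs ++ ys) (pred (suc d * suc e)) Z
subsetSumsOver-++ {m} {xs = xs} {ys} {d} {e} coprime over₁ over₂ combine .sums I with splitAt m I
... | I₁ , I₂ , refl with sums over₁ I₁ | sums over₂ I₂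
... | a , xs≡a , Z₁a | b , ys≡b , Z₂b =
  a * suc e + b * suc d ,
  trans (recipSum-++ xs ys I₁ I₂) (trans (cong₂ ℚ._+_ xs≡a ys≡b) (+-/1+ a d b e)) ,
  λ de∣ → let d∣a , e∣b = coprime-∣-split a b coprime de∣ in combine (Z₁a d∣a) (Z₂b e∣b)

-- If 1 / (1 + d) completes ds to an integer x, an integral subset sum containing it has an
-- integral complement inside ds, which must be 0.
subsetSumsOver-complete : ∀ {k} {ds : Vec ℕ k} {d x} → SubsetSumsOver ds d (_≡ 0) →
                          recipSum ds ⊤ ℚ.+ 1 /1+ d ≡ x /1+ 0 →
                          SubsetSumsOver (ds ++ [ suc d ]) d (λ A → A ≡ 0 ⊎ A ≡ x * suc d)
subsetSumsOver-complete {k} {ds} {d} {x} over total .sums J with splitAt k J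
... | I , outside ∷ [] , refl with sums over I
...   | A , ds≡A , A≡0 =
  A , trans (recipSum-++ ds _ I _) (trans (ℚ.+-identityʳ _) ds≡A) , λ 1+d∣A → inj₁ (A≡0 1+d∣A)
subsetSumsOver-complete {k} {ds} {d} {x} over total .sums J | I , inside ∷ [] , refl
  with sums over I | sums over (∁ I)
...   | A , ds≡A , _ | A′ , ds∁≡A′ , A′≡0 =
  A + 1 , trans (recipSum-++ ds _ I _) (trans (cong₂ ℚ._+_ ds≡A (ℚ.+-identityʳ _)) (+-/1+-same A 1 d)) ,
  λ 1+d∣A+1 → inj₂ (A+1≡x[1+d] (A′≡0 (∣m+n∣m⇒∣n (subst (suc d ∣_) (sym whole) (n∣m*n x)) 1+d∣A+1)))
  where
  open ≡-Reasoning
  whole : A + 1 + A′ ≡ x * suc d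
  whole = trans (sym (*-identityʳ _)) (/1+-cross⁻¹ (A + 1 + A′) d (+ x) 0 (begin
    (A + 1 + A′) /1+ d                               ≡⟨ +-/1+-same (A + 1) A′ d ⟨
    (A + 1) /1+ d ℚ.+ A′ /1+ d                       ≡⟨ cong (ℚ._+ A′ /1+ d) (+-/1+-same A 1 d) ⟨
    A /1+ d ℚ.+ 1 /1+ d ℚ.+ A′ /1+ d                 ≡⟨ xy∙z≈xz∙y (A /1+ d) (1 /1+ d) (A′ /1+ d) ⟩
    A /1+ d ℚ.+ A′ /1+ d ℚ.+ 1 /1+ d                 ≡⟨ cong (ℚ._+ 1 /1+ d) (cong₂ ℚ._+_ ds≡A ds∁≡A′) ⟨
    recipSum ds I ℚ.+ recipSum ds (∁ I) ℚ.+ 1 /1+ d  ≡⟨ cong (ℚ._+ 1 /1+ d) (subsetSum-∁ (map recip ds) I) ⟩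
    recipSum ds ⊤ ℚ.+ 1 /1+ d                        ≡⟨ total ⟩
    x /1+ 0                                          ∎))
  A+1≡x[1+d] : A′ ≡ 0 → A + 1 ≡ x * suc d
  A+1≡x[1+d] refl = trans (sym (+-identityʳ (A + 1))) whole

module Chain (L : ℕ) where

  -- Block j of chain k is M j - 1 = L * R j copies of 1 / M j, and V k / R k = Σ_{j<k} 1 / M j,
  -- so chain k sums to k - V k / R k.
  V R M : ℕ → ℕ
  V zero    = 0
  V (suc k) = R k * R k + V k
  R k = suc (L * V k)
  M k = suc (L * R k)

  R-suc : ∀ k → R (suc k) ≡ M k * R k
  R-suc k = identity L (V k)
    where
    identity : ∀ l v → suc (l * (suc (l * v) * suc (l * v) + v)) ≡ suc (l * suc (l * v)) * suc (l * v)
    identity = solve-∀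

  chainLen : ℕ → ℕ
  chainLen zero    = 0
  chainLen (suc k) = L * R k + chainLen k

  chain : ∀ k → Vec ℕ (chainLen k)
  chain zero    = []
  chain (suc k) = replicate (L * R k) (M k) ++ chain k

  chain-pos : ∀ k → All (1 ≤_) (chain k)
  chain-pos zero    = []
  chain-pos (suc k) = ++⁺ (replicate⁺ (L * R k) (s≤s z≤n)) (chain-pos k)

  chain-sums : ∀ k → SubsetSumsOver (chain k) (L * V k) (_≡ 0)
  chain-sums zero    = subsetSumsOver-[] refl
  chain-sums (suc k) = subst (λ d → SubsetSumsOver (chain (suc k)) d (_≡ 0)) (suc-injective (sym (R-suc k)))
    (subsetSumsOver-++ (Coprime.sym (∣⇒coprime-suc (n∣m*n L))) (subsetSumsOver-replicate ≤-refl) (chain-sums k)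
      λ { refl refl → refl })

  chain-total-step : ∀ k → (L * R k) /1+ (L * R k) ℚ.+ V (suc k) /1+ (L * V (suc k))
                             ≡ V k /1+ (L * V k) ℚ.+ 1 /1+ 0
  chain-total-step k = begin
    (L * r) /1+ (L * r) ℚ.+ v′ /1+ (L * v′)  ≡⟨ +-/1+ (L * r) (L * r) v′ (L * v′) ⟩
    a /1+ pred (M k * R (suc k))             ≡⟨ /1+-cross a (pred (M k * R (suc k))) b (pred (r * 1)) (identity L v) ⟩
    b /1+ pred (r * 1)                       ≡⟨ +-/1+ v (L * v) 1 0 ⟨
    v /1+ (L * v) ℚ.+ 1 /1+ 0                ∎
    where
    open ≡-Reasoning
    r = R k
    v = V k
    v′ = V (suc k)
    a = L * r * R (suc k) + v′ * M k
    b = v * 1 + 1 * r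
    identity : ∀ l v →
      (l * suc (l * v) * suc (l * (suc (l * v) * suc (l * v) + v))
         + (suc (l * v) * suc (l * v) + v) * suc (l * suc (l * v))) * (suc (l * v) * 1)
        ≡ (v * 1 + 1 * suc (l * v)) * (suc (l * suc (l * v)) * suc (l * (suc (l * v) * suc (l * v) + v)))
    identity = solve-∀

  chain-total : ∀ k → recipSum (chain k) ⊤ ℚ.+ V k /1+ (L * V k) ≡ k /1+ 0
  chain-total zero    = trans (ℚ.+-identityˡ _) (trans (0/n≡0 (suc (L * 0))) (sym (0/n≡0 1)))
  chain-total (suc k) = begin
    recipSum (block ++ chain k) ⊤ ℚ.+ V (suc k) /1+ (L * V (suc k))
      ≡⟨ cong (ℚ._+ V (suc k) /1+ (L * V (suc k))) (recipSum-⊤-++ block (chain k)) ⟩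
    recipSum block ⊤ ℚ.+ rest ℚ.+ V (suc k) /1+ (L * V (suc k))
      ≡⟨ cong (λ q → q ℚ.+ rest ℚ.+ V (suc k) /1+ (L * V (suc k))) (recipSum-replicate-⊤ (L * R k) (L * R k)) ⟩
    (L * R k) /1+ (L * R k) ℚ.+ rest ℚ.+ V (suc k) /1+ (L * V (suc k))
      ≡⟨ xy∙z≈y∙xz ((L * R k) /1+ (L * R k)) rest (V (suc k) /1+ (L * V (suc k))) ⟩
    rest ℚ.+ ((L * R k) /1+ (L * R k) ℚ.+ V (suc k) /1+ (L * V (suc k)))
      ≡⟨ cong (rest ℚ.+_) (chain-total-step k) ⟩
    rest ℚ.+ (V k /1+ (L * V k) ℚ.+ 1 /1+ 0)
      ≡⟨ ℚ.+-assoc rest (V k /1+ (L * V k)) (1 /1+ 0) ⟨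
    rest ℚ.+ V k /1+ (L * V k) ℚ.+ 1 /1+ 0
      ≡⟨ cong (ℚ._+ 1 /1+ 0) (chain-total k) ⟩
    k /1+ 0 ℚ.+ 1 /1+ 0
      ≡⟨ trans (+-/1+-same k 1 0) (cong (_/1+ 0) (+-comm k 1)) ⟩
    suc k /1+ 0 ∎
    where
    open ≡-Reasoning
    block = replicate (L * R k) (M k)
    rest = recipSum (chain k) ⊤

module Group (L : ℕ) where
  open Chain L

  -- u y / N y + 1 / (R (suc y) * N y) = V (suc y) / R (suc y) is what chain (suc y) lacks to reach suc y.
  u N : ℕ → ℕ
  u y = pred (V (suc y))
  N y = suc (L * u y)

  body : ∀ y → Vec ℕ (chainLen (suc y) + u y)
  body y = chain (suc y) ++ replicate (u y) (N y)

  groupLen : ℕ → ℕ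
  groupLen zero    = 0
  groupLen (suc y) = chainLen (suc y) + u y + 1

  group : ∀ x → Vec ℕ (groupLen x)
  group zero    = []
  group (suc y) = body y ++ [ R (suc y) * N y ]

  groupDen : ℕ → ℕ
  groupDen zero    = 0
  groupDen (suc y) = pred (R (suc y) * N y)

  L∣groupDen : ∀ x → L ∣ groupDen x
  L∣groupDen zero    = L ∣0
  L∣groupDen (suc y) = ∣-pred-suc*suc (m∣m*n (V (suc y))) (m∣m*n (u y))

  group-pos : ∀ x → All (1 ≤_) (group x)
  group-pos zero    = []
  group-pos (suc y) = ++⁺ (++⁺ (chain-pos (suc y)) (replicate⁺ (u y) (s≤s z≤n))) (s≤s z≤n ∷ [])

  R⊥N : ∀ y → Coprime (R (suc y)) (N y)
  R⊥N y = subst (λ r → Coprime r (N y)) (cong suc (trans (+-comm (L * u y) L) (sym (*-suc L (u y)))))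
    (coprime-+ (∣⇒coprime-suc (m∣m*n {L} (u y))))

  tail-sum : ∀ y → u y /1+ (L * u y) ℚ.+ 1 /1+ groupDen (suc y) ≡ V (suc y) /1+ (L * V (suc y))
  tail-sum y = trans (+-/1+ (u y) (L * u y) 1 (groupDen (suc y)))
    (/1+-cross (u y * (R (suc y) * N y) + 1 * N y) (pred (N y * (R (suc y) * N y))) (V (suc y)) (L * V (suc y))
      (identity L (u y)))
    where
    identity : ∀ l u → (u * (suc (l * suc u) * suc (l * u)) + 1 * suc (l * u)) * suc (l * suc u)
                         ≡ suc u * (suc (l * u) * (suc (l * suc u) * suc (l * u)))
    identity = solve-∀

  body-sum : ∀ y → recipSum (body y) ⊤ ℚ.+ 1 /1+ groupDen (suc y) ≡ suc y /1+ 0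
  body-sum y = begin
    recipSum (body y) ⊤ ℚ.+ 1 /1+ groupDen (suc y)
      ≡⟨ cong (ℚ._+ 1 /1+ groupDen (suc y)) (recipSum-⊤-++ (chain (suc y)) (replicate (u y) (N y))) ⟩
    chain⊤ ℚ.+ recipSum (replicate (u y) (N y)) ⊤ ℚ.+ 1 /1+ groupDen (suc y)
      ≡⟨ cong (λ q → chain⊤ ℚ.+ q ℚ.+ 1 /1+ groupDen (suc y)) (recipSum-replicate-⊤ (u y) (L * u y)) ⟩
    chain⊤ ℚ.+ u y /1+ (L * u y) ℚ.+ 1 /1+ groupDen (suc y)
      ≡⟨ ℚ.+-assoc chain⊤ (u y /1+ (L * u y)) (1 /1+ groupDen (suc y)) ⟩
    chain⊤ ℚ.+ (u y /1+ (L * u y) ℚ.+ 1 /1+ groupDen (suc y))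
      ≡⟨ cong (chain⊤ ℚ.+_) (tail-sum y) ⟩
    chain⊤ ℚ.+ V (suc y) /1+ (L * V (suc y))
      ≡⟨ chain-total (suc y) ⟩
    suc y /1+ 0 ∎
    where
    open ≡-Reasoning
    chain⊤ = recipSum (chain (suc y)) ⊤

  group-sums : .{{_ : NonZero L}} → ∀ x →
               SubsetSumsOver (group x) (groupDen x) (λ A → A ≡ 0 ⊎ A ≡ x * suc (groupDen x))
  group-sums zero    = subsetSumsOver-[] (inj₁ refl)
  group-sums (suc y) = subsetSumsOver-complete {x = suc y}
    (subsetSumsOver-++ (R⊥N y) (chain-sums (suc y)) (subsetSumsOver-replicate (m≤n*m (u y) L)) λ { refl refl → refl })
    (body-sum y)

  group-total : ∀ x → recipSum (group x) ⊤ ≡ x /1+ 0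
  group-total zero    = sym (0/n≡0 1)
  group-total (suc y) = trans (recipSum-⊤-++ (body y) [ R (suc y) * N y ])
    (trans (cong (recipSum (body y) ⊤ ℚ.+_) (ℚ.+-identityʳ (1 /1+ groupDen (suc y)))) (body-sum y))

open Group using (groupLen; group; groupDen; L∣groupDen; group-pos; group-sums; group-total)

-- Later groups use a multiple of L * (1 + groupDen L x) as parameter, so their denominators are
-- ≡ 1 modulo those of earlier groups.
nextL : ℕ → ℕ → ℕ
nextL L x = L * suc (groupDen L x)

expansionLen : ℕ → ∀ {e} → Vec ℕ e → ℕ
expansionLen L []       = 0
expansionLen L (x ∷ ms) = groupLen L x + expansionLen (nextL L x) ms

expansion : ∀ L {e} (ms : Vec ℕ e) → Vec ℕ (expansionLen L ms)
expansion L []       = []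
expansion L (x ∷ ms) = group L x ++ expansion (nextL L x) ms

expansionDen : ℕ → ∀ {e} → Vec ℕ e → ℕ
expansionDen L []       = 0
expansionDen L (x ∷ ms) = pred (suc (groupDen L x) * suc (expansionDen (nextL L x) ms))

groupsOf : ∀ L {e} (ms : Vec ℕ e) → Subset e → Subset (expansionLen L ms)
groupsOf L []       []      = []
groupsOf L (x ∷ ms) (b ∷ J) = replicate (groupLen L x) b ++ groupsOf (nextL L x) ms J

L∣expansionDen : ∀ L {e} (ms : Vec ℕ e) → L ∣ expansionDen L ms
L∣expansionDen L []       = L ∣0
L∣expansionDen L (x ∷ ms) =
  ∣-pred-suc*suc (L∣groupDen L x) (∣-trans (m∣m*n (suc (groupDen L x))) (L∣expansionDen (nextL L x) ms))

expansion-pos : ∀ L {e} (ms : Vec ℕ e) → All (1 ≤_) (expansion L ms)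
expansion-pos L []       = []
expansion-pos L (x ∷ ms) = ++⁺ (group-pos L x) (expansion-pos (nextL L x) ms)

expansion-sums : ∀ L .{{_ : NonZero L}} {e} (ms : Vec ℕ e) →
                 SubsetSumsOver (expansion L ms) (expansionDen L ms)
                   (λ A → ∃ λ J → A ≡ subsetSumℕ ms J * suc (expansionDen L ms))
expansion-sums L []       = subsetSumsOver-[] ([] , refl)
expansion-sums L (x ∷ ms) =
  subsetSumsOver-++ coprime (group-sums L x) (expansion-sums (nextL L x) {{m*n≢0 L (suc D)}} ms) combine
  where
  D = groupDen L x
  Q = expansionDen (nextL L x) ms
  coprime : Coprime (suc D) (suc Q)
  coprime = ∣⇒coprime-suc (∣-trans (n∣m*n L) (L∣expansionDen (nextL L x) ms))
  numerator-outside : ∀ t d q → 0 * suc q + t * suc q * suc d ≡ t * (suc d * suc q)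
  numerator-outside = solve-∀
  numerator-inside : ∀ x t d q → x * suc d * suc q + t * suc q * suc d ≡ (x + t) * (suc d * suc q)
  numerator-inside = solve-∀
  combine : ∀ {a b} → a ≡ 0 ⊎ a ≡ x * suc D → (∃ λ J → b ≡ subsetSumℕ ms J * suc Q) →
            ∃ λ J → a * suc Q + b * suc D ≡ subsetSumℕ (x ∷ ms) J * (suc D * suc Q)
  combine (inj₁ refl) (J , refl) = outside ∷ J , numerator-outside (subsetSumℕ ms J) D Q
  combine (inj₂ refl) (J , refl) = inside ∷ J , numerator-inside x (subsetSumℕ ms J) D Q

recipSum-groupsOf : ∀ L {e} (ms : Vec ℕ e) J → recipSum (expansion L ms) (groupsOf L ms J) ≡ subsetSumℕ ms J /1+ 0
recipSum-groupsOf L []       []            = sym (0/n≡0 1)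
recipSum-groupsOf L (x ∷ ms) (inside ∷ J)  =
  trans (recipSum-++ (group L x) (expansion (nextL L x) ms) ⊤ (groupsOf (nextL L x) ms J))
    (trans (cong₂ ℚ._+_ (group-total L x) (recipSum-groupsOf (nextL L x) ms J)) (+-/1+-same x (subsetSumℕ ms J) 0))
recipSum-groupsOf L (x ∷ ms) (outside ∷ J) =
  trans (recipSum-++ (group L x) (expansion (nextL L x) ms) ⊥ (groupsOf (nextL L x) ms J))
    (trans (cong₂ ℚ._+_ (subsetSum-⊥ (map recip (group L x))) (recipSum-groupsOf (nextL L x) ms J))
      (ℚ.+-identityˡ (subsetSumℕ ms J /1+ 0)))

groupsOf-⊤ : ∀ L {e} (ms : Vec ℕ e) → groupsOf L ms ⊤ ≡ ⊤
groupsOf-⊤ L []       = refl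
groupsOf-⊤ L (x ∷ ms) =
  trans (cong (replicate (groupLen L x) inside ++_) (groupsOf-⊤ (nextL L x) ms)) (sym (replicate-++ (groupLen L x) inside))

L≤expansionLen : ∀ L y {e} (ms : Vec ℕ e) → L ≤ expansionLen L (suc y ∷ ms)
L≤expansionLen L y ms = begin
  L                            ≤⟨ m≤m*n L (R y) ⟩
  L * R y                      ≤⟨ m≤m+n (L * R y) (chainLen y) ⟩
  chainLen (suc y)             ≤⟨ m≤m+n (chainLen (suc y)) (u y) ⟩
  chainLen (suc y) + u y       ≤⟨ m≤m+n (chainLen (suc y) + u y) 1 ⟩
  groupLen L (suc y)           ≤⟨ m≤m+n (groupLen L (suc y)) (expansionLen (nextL L (suc y)) ms) ⟩
  expansionLen L (suc y ∷ ms)  ∎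
  where
  open ≤-Reasoning
  open Chain L using (R; chainLen)
  open Group L using (u)

module Solution (n′ L : ℕ) .{{_ : NonZero L}} {e} (ms : Vec ℕ e) where

  ds : Vec ℕ (expansionLen L ms)
  ds = expansion L ms

  D : ℕ
  D = expansionDen L ms

  ns : Vec ℕ (expansionLen L ms)
  ns = map (suc n′ *_) ds

  private
    *-swapʳ : ∀ a b c → a * b * c ≡ a * (c * b)
    *-swapʳ = solve-∀

  recipSum-ns : ∀ I A d → recipSum ds I ≡ A /1+ d → recipSum ns I ≡ A /1+ pred (suc n′ * suc d)
  recipSum-ns I A d ds≡A = begin
    recipSum ns I                      ≡⟨ recipSum-map-* (suc n′) ds I ⟩
    1 /1+ n′ ℚ.* recipSum ds I         ≡⟨ cong (1 /1+ n′ ℚ.*_) ds≡A ⟩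
    1 /1+ n′ ℚ.* A /1+ d               ≡⟨ *-/1+ 1 n′ A d ⟩
    (1 * A) /1+ pred (suc n′ * suc d)  ≡⟨ cong (_/1+ pred (suc n′ * suc d)) (*-identityˡ A) ⟩
    A /1+ pred (suc n′ * suc d)        ∎
    where open ≡-Reasoning

  recipSum-ns-groupsOf : ∀ J → recipSum ns (groupsOf L ms J) ≡ subsetSumℕ ms J /1+ n′
  recipSum-ns-groupsOf J = trans (recipSum-ns (groupsOf L ms J) t 0 (recipSum-groupsOf L ms J))
    (/1+-cross t (pred (suc n′ * 1)) t n′ (cong (t *_) (sym (*-identityʳ (suc n′)))))
    where t = subsetSumℕ ms J

  numerator-multiple : ∀ A d (c : ℤ) → A /1+ pred (suc n′ * suc d) ≡ c / suc n′ → A ≡ ℤ.∣ c ∣ * suc d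
  numerator-multiple A d c eq = *-cancelʳ-≡ A (ℤ.∣ c ∣ * suc d) (suc n′)
    (trans (/1+-cross⁻¹ A (pred (suc n′ * suc d)) c n′ eq) (sym (*-swapʳ ℤ.∣ c ∣ (suc d) (suc n′))))

  inFracZ⇒partSum : ∀ I (c : ℤ) → recipSum ns I ≡ c / suc n′ →
                    ∃ λ J → recipSum ns I ≡ subsetSumℕ ms J /1+ n′
  inFracZ⇒partSum I c ns≡c with sums (expansion-sums L ms) I
  ... | A , ds≡A , integral
    with integral (divides ℤ.∣ c ∣ (numerator-multiple A D c (trans (sym (recipSum-ns I A D ds≡A)) ns≡c)))
  ...   | J , refl = J , trans (recipSum-ns I (t * suc D) D ds≡A)
    (/1+-cross (t * suc D) (pred (suc n′ * suc D)) t n′ (*-swapʳ t (suc D) (suc n′)))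
    where t = subsetSumℕ ms J

  S⇔T : ∀ q → S (suc n′) ns q ⇔ T (suc n′) ms q
  S⇔T q = mk⇔ to from
    where
    to : S (suc n′) ns q → T (suc n′) ms q
    to ((I , q≡) , c , q≡c) with inFracZ⇒partSum I c (trans (sym q≡) q≡c)
    ... | J , ns≡t = J , trans q≡ (trans ns≡t (sym (subsetSum-/1+ ms n′ J)))
    from : T (suc n′) ms q → S (suc n′) ns q
    from (J , q≡) = (groupsOf L ms J , trans q≡t (sym (recipSum-ns-groupsOf J))) , + subsetSumℕ ms J , q≡t
      where q≡t = trans q≡ (subsetSum-/1+ ms n′ J)

  total : ∀ {m} → sum ms ≡ m → + m / suc n′ ≡ sumℚ (map recip ns)
  total refl = sym (begin
    sumℚ (map recip ns)            ≡⟨ sumℚ≡subsetSum-⊤ (map recip ns) ⟩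
    recipSum ns ⊤                  ≡⟨ cong (recipSum ns) (groupsOf-⊤ L ms) ⟨
    recipSum ns (groupsOf L ms ⊤)  ≡⟨ recipSum-ns-groupsOf ⊤ ⟩
    subsetSumℕ ms ⊤ /1+ n′         ≡⟨ cong (_/1+ n′) (subsetSumℕ-⊤ ms) ⟩
    sum ms /1+ n′                  ∎)
    where open ≡-Reasoning

  ns-pos : ∀ i → 1 ≤ lookup ns i
  ns-pos = lookup⁺ (map⁺ {P = 1 ≤_} {f = suc n′ *_} (All.map 1≤[1+n′]* (expansion-pos L ms)))
    where
    1≤[1+n′]* : ∀ {d} → 1 ≤ d → 1 ≤ suc n′ * d
    1≤[1+n′]* (s≤s z≤n) = s≤s z≤n

longer⇒∉ : ∀ (sols : List (Σ ℕ (Vec ℕ))) {sol} → max 0 (List.map proj₁ sols) < proj₁ sol → sol ∉ sols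
longer⇒∉ sols longer sol∈sols =
  <⇒≱ longer (ListAll.lookup (xs≤max 0 (List.map proj₁ sols)) (∈-map⁺ proj₁ sol∈sols))

theorem1p3 : (m n : ℕ) → .{{_ : NonZero n}} → 1 ≤ m → Coprime m n →
    (e : ℕ) → 1 ≤ e → (ms : Vec ℕ e) →
    (∀ i → 1 ≤ lookup ms i) → (∀ i → lookup ms i ≤ m) →
    (∀ (i j : Fin e) → i ≤ᶠ j → lookup ms i ≤ lookup ms j) →
    sum ms ≡ m →
    (L : List (Σ ℕ (Vec ℕ))) → ∃ λ sol → Good m n ms sol × sol ∉ L
theorem1p3 _ zero {{()}}
theorem1p3 _ (suc n′) _ _ zero () _ _ _ _ _ _
theorem1p3 _ (suc n′) _ _ (suc _) _ (_ ∷ ms) pos _ _ sum≡m sols with pos Fin.zero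
... | s≤s {n = y} z≤n =
  (expansionLen L (suc y ∷ ms) , ns) ,
  (≤-trans (s≤s z≤n) L≤k , ns-pos , total sum≡m , S⇔T) ,
  longer⇒∉ sols L≤k
  where
  L = suc (max 0 (List.map proj₁ sols))
  L≤k = L≤expansionLen L y ms
  open Solution n′ L (suc y ∷ ms)
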